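{- Let $G$ be a directed graph with $n$ vertices. Throughout any sequence of edge deletions applied to $G$, at most $2(n-1)$ distinct edges are strong bridges of the current graph at some point.
   Context: An edge of the current graph is a strong bridge if its removal increases the number of strongly connected components of the current graph. -}

module Defs where

open import Data.Nat using (ℕ; _<_)
open import Data.Fin using (Fin)
open import Data.Fin.Subset using (Subset; _∈_; ⊤; outside)
open import Data.Vec using (_[_]≔_)
open import Data.List using (List; []; _∷_)
open import Data.Product using (Σ; ∃; ∃₂; _×_)
open import Relation.Binary.PropositionalEquality using (_≡_)

-- Each edge e goes from tail e to head e.  (Simple digraphs are the special
-- case where distinct edges have distinct (tail, head) pairs.)
record Digraph (n : ℕ) : Set where
  field
    m    : ℕ
    tail : Fin m → Fin n
    head : Fin m → Fin n
open Digraph public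

-- A "current graph": the sub-graph of G keeping exactly the edges in S.
-- Reachability in the current graph S (a directed path of zero or more edges of S).
data Reach {n} (G : Digraph n) (S : Subset (m G)) : Fin n → Fin n → Set where
  here : ∀ {u} → Reach G S u u
  step : ∀ {u v} (e : Fin (m G)) → e ∈ S → tail G e ≡ u →
         Reach G S (head G e) v → Reach G S u v

SameSCC : ∀ {n} (G : Digraph n) → Subset (m G) → Fin n → Fin n → Set
SameSCC G S u v = Reach G S u v × Reach G S v u

-- The current graph S has exactly k strongly connected components:
-- there is a surjective labelling of the vertices by Fin k whose fibres are
-- exactly the SCCs (the equivalence classes of mutual reachability).
HasSCCCount : ∀ {n} (G : Digraph n) → Subset (m G) → ℕ → Set
HasSCCCount {n} G S k =
  Σ (Fin n → Fin k) λ f →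
    (∀ (c : Fin k) → ∃ λ v → f v ≡ c) ×
    (∀ u v → f u ≡ f v → SameSCC G S u v) ×
    (∀ u v → SameSCC G S u v → f u ≡ f v)

delete : ∀ {m} → Subset m → Fin m → Subset m
delete S e = S [ e ]≔ outside

StrongBridge : ∀ {n} (G : Digraph n) → Subset (m G) → Fin (m G) → Set
StrongBridge G S e =
  e ∈ S × ∃₂ λ k k′ → HasSCCCount G S k × HasSCCCount G (delete S e) k′ × k < k′

-- All current graphs occurring when the edges of the list are deleted one by
-- one, starting from S (the list includes S itself and the final graph).
graphsFrom : ∀ {m} → Subset m → List (Fin m) → List (Subset m)
graphsFrom S []       = S ∷ []
graphsFrom S (e ∷ es) = S ∷ graphsFrom (delete S e) es

graphsDuring : ∀ {n} (G : Digraph n) → List (Fin (m G)) → List (Subset (m G))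
graphsDuring G ds = graphsFrom ⊤ ds

-- Let Φ(S) = n − #SCC(S), the number of vertices that are not the first vertex of their strongly
-- connected component. Φ ≤ n − 1, and deletions never increase Φ. When an edge d = (a, b) is
-- deleted from S, at most 2 (Φ(S) − Φ(S − d)) edges stop being strong bridges: if d is not a
-- strong bridge the SCCs do not change and no bridge is lost; otherwise the SCC C of d falls apart
-- into k pieces, creating k − 1 new representatives. A lost bridge f ≠ d lies in C, and in
-- S − d − f either b no longer reaches head f ("f enters" the piece of head f) or tail f no longer
-- reaches a ("f exits" the piece of tail f). Charging f to that piece, with a flag for entering or
-- exiting, is injective; d is charged as entering the piece of b, and the piece of a is never
-- charged, so at most 2 (k − 1) bridges are lost. Summing along the deletion sequence, extended by
-- deleting all remaining edges so that every bridge eventually stops being one, bounds the number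
-- of distinct bridges by 2 Φ(G) ≤ 2 (n − 1).
module Submission where

open import Defs
open import Function using (id)
open import Data.Nat using (ℕ; zero; suc; _≤_; _<_; _*_; _∸_; _+_; z≤n; s≤s)
open import Data.Nat.Properties
  using ( <-≤-trans; ≤-pred; <⇒≱; +-identityʳ; +-monoˡ-≤; +-monoʳ-≤; *-monoʳ-≤; *-distribˡ-+
        ; module ≤-Reasoning)
open import Data.Fin using (Fin; _≟_)
import Data.Fin.Properties
open import Data.Fin.Subset using (Subset; ⊤; outside; ∣_∣; _⊆_) renaming (_∈_ to _∈ₛ_; _∉_ to _∉ₛ_)
open import Data.Fin.Subset.Properties using (_∈?_; ∈⊤; ∣p∣≤n; p⊂q⇒∣p∣<∣q∣)
open import Data.Vec.Properties
  using ([]≔-minimal; []≔-updates; []=-injective; []=⇒lookup; lookup⇒[]=; lookup∘update′)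
open import Data.List using (List; []; _∷_; length; allFin; filter; map; _++_)
open import Data.List.Membership.Propositional using (_∈_; lose)
open import Data.List.Membership.Propositional.Properties
  using (∈-filter⁺; ∈-filter⁻; ∈-allFin; ∈-++⁺ˡ; ∈-++⁺ʳ; ∈-++⁻; ∈-map⁺; ∈-map⁻)
open import Data.List.Properties using (filter-notAll; filter-none; length-tabulate; length-++; length-map)
open import Data.List.Relation.Unary.Any as Any using (Any; here; there; any?)
open import Data.List.Relation.Unary.All as All using (All; []; _∷_)
import Data.List.Relation.Unary.All.Properties as All
open import Data.List.Relation.Unary.AllPairs using ([]; _∷_)
open import Data.List.Relation.Unary.Unique.Propositional using (Unique)
open import Data.List.Relation.Unary.Unique.Propositional.Properties using (++⁺; filter⁺; allFin⁺)
open import Data.List.Relation.Binary.Disjoint.Propositional using (Disjoint)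
open import Data.Product using (∃; _×_; _,_; proj₁; proj₂)
open import Data.Sum using (_⊎_; inj₁; inj₂; reduce)
import Data.Sum as Sum
import Data.Sum.Properties as Sum
open import Data.Sum.Properties using (inj₁-injective; inj₂-injective)
open import Data.Sum.Relation.Binary.Pointwise using (Pointwise; inj₁; inj₂)
open import Relation.Nullary using (¬_; Dec; yes; no; contradiction)
open import Relation.Nullary.Decidable using (_×-dec_; ¬?; map′)
open import Relation.Binary.Core using (_⇒_)
open import Relation.Binary.Definitions using (DecidableEquality; Decidable; Reflexive)
open import Relation.Binary.Structures using (IsEquivalence)
open import Relation.Binary.PropositionalEquality using (_≡_; _≢_; refl; sym; trans; cong₂; subst)

private variable
  k : ℕ
  A B : Set

unique-⊆⇒length≤ : DecidableEquality A → {xs ys : List A} → Unique xs →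
                   (∀ {x} → x ∈ xs → x ∈ ys) → length xs ≤ length ys
unique-⊆⇒length≤ _≟ₐ_ {[]} _ _ = z≤n
unique-⊆⇒length≤ _≟ₐ_ {x ∷ xs} {ys} (x∉xs ∷ xs!) xs⊆ys =
  <-≤-trans (s≤s (unique-⊆⇒length≤ _≟ₐ_ xs! xs⊆ys-x))
            (filter-notAll (λ y → ¬? (x ≟ₐ y)) ys
                           (Any.map (λ x≡y x≢y → x≢y x≡y) (xs⊆ys (here refl))))
  where
  xs⊆ys-x : ∀ {y} → y ∈ xs → y ∈ filter (λ y → ¬? (x ≟ₐ y)) ys
  xs⊆ys-x y∈xs = ∈-filter⁺ (λ y → ¬? (x ≟ₐ y)) (xs⊆ys (there y∈xs)) (All.lookup x∉xs y∈xs)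

map-unique : {f : A → B} {xs : List A} → Unique xs →
             (∀ {x y} → x ∈ xs → y ∈ xs → f x ≡ f y → x ≡ y) → Unique (map f xs)
map-unique {xs = []} [] _ = []
map-unique {xs = x ∷ xs} (x∉xs ∷ xs!) inj =
  All.map⁺ (All.tabulate λ y∈xs fx≡fy → All.lookup x∉xs y∈xs (inj (here refl) (there y∈xs) fx≡fy))
  ∷ map-unique xs! (λ x∈ y∈ → inj (there x∈) (there y∈))

∉-delete : ∀ {p : Subset k} {i} → i ∉ₛ delete p i
∉-delete {p = p} {i} i∈ with () ← []=-injective i∈ ([]≔-updates p i)

∈-delete⇒≢ : ∀ {p : Subset k} {i j} → j ∈ₛ delete p i → j ≢ i
∈-delete⇒≢ j∈ refl = ∉-delete j∈

∈-delete⁺ : ∀ {p : Subset k} {i j} → j ∈ₛ p → j ≢ i → j ∈ₛ delete p i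
∈-delete⁺ {p = p} j∈ j≢i = []≔-minimal p _ _ j≢i j∈

delete-⊆ : ∀ {p : Subset k} {i} → delete p i ⊆ p
delete-⊆ {p = p} {x = j} j∈ =
  lookup⇒[]= j p (trans (sym (lookup∘update′ (∈-delete⇒≢ j∈) p outside)) ([]=⇒lookup j∈))

delete-mono : ∀ {p q : Subset k} {i} → p ⊆ q → delete p i ⊆ delete q i
delete-mono p⊆q j∈ = ∈-delete⁺ (p⊆q (delete-⊆ j∈)) (∈-delete⇒≢ j∈)

∣delete∣< : ∀ {p : Subset k} {i} → i ∈ₛ p → ∣ delete p i ∣ < ∣ p ∣
∣delete∣< i∈ = p⊂q⇒∣p∣<∣q∣ (delete-⊆ , _ , i∈ , ∉-delete)

module _ {R : A → A → Set} (R? : Decidable R) where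

  firstRelated : A → List A → A
  firstRelated v [] = v
  firstRelated v (w ∷ ws) with R? w v
  ... | yes _ = w
  ... | no _ = firstRelated v ws

  firstRelated-related : Reflexive R → ∀ {v} ws → R (firstRelated v ws) v
  firstRelated-related refl′ [] = refl′
  firstRelated-related refl′ {v} (w ∷ ws) with R? w v
  ... | yes Rwv = Rwv
  ... | no _ = firstRelated-related refl′ ws

  firstRelated-head : Reflexive R → ∀ {v} ws → firstRelated v (v ∷ ws) ≡ v
  firstRelated-head refl′ {v} ws with R? v v
  ... | yes _ = refl
  ... | no ¬Rvv = contradiction refl′ ¬Rvv

  firstRelated-cong : IsEquivalence R → ∀ {v v′ ws} → R v v′ → v ∈ ws →
                      firstRelated v ws ≡ firstRelated v′ ws
  firstRelated-cong equiv {v} {v′} {w ∷ ws} Rvv′ v∈ with R? w v | R? w v′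
  ... | yes _ | yes _ = refl
  ... | yes Rwv | no ¬Rwv′ = contradiction (IsEquivalence.trans equiv Rwv Rvv′) ¬Rwv′
  ... | no ¬Rwv | yes Rwv′ = contradiction (IsEquivalence.trans equiv Rwv′ (IsEquivalence.sym equiv Rvv′)) ¬Rwv
  ... | no ¬Rwv | no _ with v∈
  ...   | here refl = contradiction (IsEquivalence.refl equiv) ¬Rwv
  ...   | there v∈ws = firstRelated-cong equiv Rvv′ v∈ws

  length-nonFirst : (_≟ₐ_ : DecidableEquality A) → Reflexive R → ∀ ws →
                    length (filter (λ w → ¬? (firstRelated w ws ≟ₐ w)) ws) ≤ length ws ∸ 1
  length-nonFirst _ refl′ [] = z≤n
  length-nonFirst _≟ₐ_ refl′ (w ∷ ws) =
    ≤-pred (filter-notAll (λ x → ¬? (firstRelated x (w ∷ ws) ≟ₐ x)) (w ∷ ws)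
                          (here λ ¬first → ¬first (firstRelated-head refl′ ws)))

firstRelated-fixed-⇒ : {R R′ : A → A → Set} (R? : Decidable R) (R′? : Decidable R′) →
                       R′ ⇒ R → Reflexive R′ →
                       ∀ {v} ws → firstRelated R? v ws ≡ v → firstRelated R′? v ws ≡ v
firstRelated-fixed-⇒ R? R′? R′⇒R refl′ [] _ = refl
firstRelated-fixed-⇒ R? R′? R′⇒R refl′ {v} (w ∷ ws) fixed with R? w v | R′? w v
... | yes _ | yes _ = fixed
... | yes _ | no ¬R′wv rewrite fixed = contradiction refl′ ¬R′wv
... | no ¬Rwv | yes R′wv = contradiction (R′⇒R R′wv) ¬Rwv
... | no _ | no _ = firstRelated-fixed-⇒ R? R′? R′⇒R refl′ ws fixed

graphsFrom-head : ∀ {P : Subset k → Set} {p} ds → P p → Any P (graphsFrom p ds)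
graphsFrom-head [] Pp = here Pp
graphsFrom-head (_ ∷ _) Pp = here Pp

graphsFrom-++ : ∀ {P : Subset k → Set} {p} ds ys →
                Any P (graphsFrom p ds) → Any P (graphsFrom p (ds ++ ys))
graphsFrom-++ [] ys (here Pp) = graphsFrom-head ys Pp
graphsFrom-++ (_ ∷ _) ys (here Pp) = here Pp
graphsFrom-++ (_ ∷ ds) ys (there later) = there (graphsFrom-++ ds ys later)

module _ {n} (G : Digraph n) where

  private variable
    S T : Subset (m G)
    W : Subset n
    u v w x y : Fin n
    e f g : Fin (m G)

  reach-trans : Reach G S u v → Reach G S v w → Reach G S u w
  reach-trans here q = q
  reach-trans (step e e∈ eq p) q = step e e∈ eq (reach-trans p q)

  reach-mono : S ⊆ T → Reach G S u v → Reach G T u v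
  reach-mono S⊆T here = here
  reach-mono S⊆T (step e e∈ eq p) = step e (S⊆T e∈) eq (reach-mono S⊆T p)

  edge-reach : e ∈ₛ S → Reach G S (tail G e) (head G e)
  edge-reach e∈ = step _ e∈ refl here

  reach-first-use : Reach G S u v →
                    Reach G (delete S f) u v ⊎ (Reach G (delete S f) u (tail G f) × Reach G S (head G f) v)
  reach-first-use here = inj₁ here
  reach-first-use {f = f} (step e e∈ refl p) with e ≟ f | reach-first-use {f = f} p
  ... | yes refl | _ = inj₂ (here , p)
  ... | no e≢f | inj₁ q = inj₁ (step e (∈-delete⁺ e∈ e≢f) refl q)
  ... | no e≢f | inj₂ (q , r) = inj₂ (step e (∈-delete⁺ e∈ e≢f) refl q , r)

  reach-last-use : Reach G S u v → Reach G (delete S f) u v ⊎ Reach G (delete S f) (head G f) v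
  reach-last-use here = inj₁ here
  reach-last-use {f = f} (step e e∈ refl p) with reach-last-use {f = f} p | e ≟ f
  ... | inj₂ q | _ = inj₂ q
  ... | inj₁ q | yes refl = inj₂ q
  ... | inj₁ q | no e≢f = inj₁ (step e (∈-delete⁺ e∈ e≢f) refl q)

  reach-to-tail : Reach G S u (tail G f) → Reach G (delete S f) u (tail G f)
  reach-to-tail p with reach-first-use p
  ... | inj₁ q = q
  ... | inj₂ (q , _) = q

  reach-from-head : Reach G S (head G f) v → Reach G (delete S f) (head G f) v
  reach-from-head p with reach-last-use p
  ... | inj₁ q = q
  ... | inj₂ q = q

  reach-bypass : Reach G (delete S f) (tail G f) (head G f) → Reach G S u v → Reach G (delete S f) u v
  reach-bypass detour here = here
  reach-bypass {f = f} detour (step e e∈ refl p) with e ≟ f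
  ... | yes refl = reach-trans detour (reach-bypass detour p)
  ... | no e≢f = step e (∈-delete⁺ e∈ e≢f) refl (reach-bypass detour p)

  data ReachWithin (S : Subset (m G)) (W : Subset n) : Fin n → Fin n → Set where
    done : u ∈ₛ W → ReachWithin S W u u
    next : (e : Fin (m G)) → e ∈ₛ S → tail G e ≡ u → u ∈ₛ W →
           ReachWithin S W (head G e) v → ReachWithin S W u v

  reachWithin⇒reach : ReachWithin S W u v → Reach G S u v
  reachWithin⇒reach (done _) = here
  reachWithin⇒reach (next e e∈ eq _ p) = step e e∈ eq (reachWithin⇒reach p)

  reach⇒reachWithin⊤ : Reach G S u v → ReachWithin S ⊤ u v
  reach⇒reachWithin⊤ here = done ∈⊤
  reach⇒reachWithin⊤ (step e e∈ eq p) = next e e∈ eq ∈⊤ (reach⇒reachWithin⊤ p)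

  reachWithin-source : ReachWithin S W u v → u ∈ₛ W
  reachWithin-source (done u∈) = u∈
  reachWithin-source (next _ _ _ u∈ _) = u∈

  reachWithin-delete : ReachWithin S (delete W w) u v → ReachWithin S W u v
  reachWithin-delete (done u∈) = done (delete-⊆ u∈)
  reachWithin-delete (next e e∈ eq u∈ p) = next e e∈ eq (delete-⊆ u∈) (reachWithin-delete p)

  LeavesFor : Subset (m G) → Subset n → Fin n → Fin n → Fin (m G) → Set
  LeavesFor S W u v e = e ∈ₛ S × tail G e ≡ u × ReachWithin S (delete W u) (head G e) v

  -- Cut the path at its last visit of u.
  reachWithin-last-visit : ReachWithin S W x v →
                           ReachWithin S (delete W u) x v ⊎ u ≡ v ⊎ ∃ (LeavesFor S W u v)
  reachWithin-last-visit {u = u} (done {u = x} x∈) with x ≟ u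
  ... | yes refl = inj₂ (inj₁ refl)
  ... | no x≢u = inj₁ (done (∈-delete⁺ x∈ x≢u))
  reachWithin-last-visit {u = u} (next {u = x} e e∈ eq x∈ p) with reachWithin-last-visit {u = u} p | x ≟ u
  ... | inj₂ later | _ = inj₂ later
  ... | inj₁ q | yes refl = inj₂ (inj₂ (e , e∈ , eq , q))
  ... | inj₁ q | no x≢u = inj₁ (next e e∈ eq (∈-delete⁺ x∈ x≢u) q)

  reachWithin? : ∀ k S W → ∣ W ∣ ≤ k → ∀ u v → Dec (ReachWithin S W u v)
  reachWithin? k S W ∣W∣≤k u v with u ∈? W | u ≟ v | k
  ... | no u∉W | _ | _ = no λ p → u∉W (reachWithin-source p)
  ... | yes u∈W | yes refl | _ = yes (done u∈W)
  ... | yes u∈W | no _ | zero = contradiction (<-≤-trans (∣delete∣< u∈W) ∣W∣≤k) λ ()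
  ... | yes u∈W | no u≢v | suc k
    with Data.Fin.Properties.any? (λ e → (e ∈? S) ×-dec (tail G e ≟ u) ×-dec
           reachWithin? k S (delete W u) (≤-pred (<-≤-trans (∣delete∣< u∈W) ∣W∣≤k)) (head G e) v)
  ...   | yes (e , e∈ , eq , p) = yes (next e e∈ eq u∈W (reachWithin-delete p))
  ...   | no ¬leaves = no λ p → impossible (reachWithin-last-visit p)
    where
    impossible : ¬ (ReachWithin S (delete W u) u v ⊎ u ≡ v ⊎ ∃ (LeavesFor S W u v))
    impossible (inj₁ p′) = ∉-delete (reachWithin-source p′)
    impossible (inj₂ (inj₁ u≡v)) = u≢v u≡v
    impossible (inj₂ (inj₂ leaves)) = ¬leaves leaves

  reach? : ∀ S u v → Dec (Reach G S u v)
  reach? S u v = map′ reachWithin⇒reach reach⇒reachWithin⊤ (reachWithin? n S ⊤ (∣p∣≤n ⊤) u v)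

  sameSCC-isEquivalence : IsEquivalence (SameSCC G S)
  sameSCC-isEquivalence = record
    { refl = here , here
    ; sym = λ (p , q) → q , p
    ; trans = λ (p , q) (p′ , q′) → reach-trans p p′ , reach-trans q′ q
    }

  module _ {S : Subset (m G)} where
    open IsEquivalence (sameSCC-isEquivalence {S}) public
      renaming (refl to sameSCC-refl; sym to sameSCC-sym; trans to sameSCC-trans)

  sameSCC? : ∀ S u v → Dec (SameSCC G S u v)
  sameSCC? S u v = reach? S u v ×-dec reach? S v u

  sameSCC-mono : S ⊆ T → SameSCC G S u v → SameSCC G T u v
  sameSCC-mono S⊆T (p , q) = reach-mono S⊆T p , reach-mono S⊆T q

  closed-through : f ∈ₛ S → Reach G S u (tail G f) → Reach G S (head G f) u →
                   SameSCC G S u (tail G f) × SameSCC G S (tail G f) (head G f)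
  closed-through f∈ u⇝t h⇝u =
    (u⇝t , reach-trans (edge-reach f∈) h⇝u) , (edge-reach f∈ , reach-trans h⇝u u⇝t)

  sameSCC-delete : f ∈ₛ S → SameSCC G S u v →
                   SameSCC G (delete S f) u v ⊎ (SameSCC G S u (tail G f) × SameSCC G S (tail G f) (head G f))
  sameSCC-delete {f = f} f∈ (p , q) with reach-first-use {f = f} p | reach-first-use {f = f} q
  ... | inj₁ p′ | inj₁ q′ = inj₁ (p′ , q′)
  ... | inj₂ (u⇝t , h⇝v) | _ = inj₂ (closed-through f∈ (reach-mono delete-⊆ u⇝t) (reach-trans h⇝v q))
  ... | inj₁ _ | inj₂ (v⇝t , h⇝u) =
    inj₂ (closed-through f∈ (reach-trans p (reach-mono delete-⊆ v⇝t)) h⇝u)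

  sameSCC⇒reach-delete : f ∈ₛ S → ¬ SameSCC G S (tail G f) (head G f) →
                         SameSCC G S x y → Reach G (delete S f) x y
  sameSCC⇒reach-delete {f = f} f∈ t≁h (p , q) with reach-first-use {f = f} p
  ... | inj₁ p′ = p′
  ... | inj₂ (x⇝t , h⇝y) =
    contradiction (edge-reach f∈ , reach-trans h⇝y (reach-trans q (reach-mono delete-⊆ x⇝t))) t≁h

  -- A local characterisation of strong bridges; only strongBridge⇒bridge is needed.
  Bridge : Subset (m G) → Fin (m G) → Set
  Bridge S f = f ∈ₛ S × SameSCC G S (tail G f) (head G f) × ¬ SameSCC G (delete S f) (tail G f) (head G f)

  bridge? : ∀ S f → Dec (Bridge S f)
  bridge? S f =
    (f ∈? S) ×-dec sameSCC? S (tail G f) (head G f) ×-dec ¬? (sameSCC? (delete S f) (tail G f) (head G f))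

  bridge-⊆ : Bridge S f → T ⊆ S → f ∈ₛ T → SameSCC G T (tail G f) (head G f) → Bridge T f
  bridge-⊆ (_ , _ , split) T⊆S f∈T t~h =
    f∈T , t~h , λ t~h′ → split (sameSCC-mono (delete-mono T⊆S) t~h′)

  sameSCC-delete-nonBridge : ¬ Bridge S f → SameSCC G S u v → SameSCC G (delete S f) u v
  sameSCC-delete-nonBridge {S = S} {f = f} ¬bridge u~v with f ∈? S
  ... | no f∉S = sameSCC-mono (λ e∈ → ∈-delete⁺ e∈ λ { refl → f∉S e∈ }) u~v
  ... | yes f∈S with sameSCC-delete f∈S u~v | sameSCC? (delete S f) (tail G f) (head G f)
  ...   | inj₁ u~v′ | _ = u~v′
  ...   | inj₂ _ | yes (detour , _) = reach-bypass detour (proj₁ u~v) , reach-bypass detour (proj₂ u~v)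
  ...   | inj₂ (_ , t~h) | no split = contradiction (f∈S , t~h , split) ¬bridge

  sccCount-anti : ∀ {k k′} → HasSCCCount G S k → HasSCCCount G T k′ →
                  SameSCC G S ⇒ SameSCC G T → k′ ≤ k
  sccCount-anti (c , _ , c-sound , _) (c′ , c′-onto , _ , c′-complete) S⇒T =
    Data.Fin.Properties.injective⇒≤ {f = λ i → c (proj₁ (c′-onto i))} λ {i} {j} eq →
      trans (sym (proj₂ (c′-onto i))) (trans (c′-complete _ _ (S⇒T (c-sound _ _ eq))) (proj₂ (c′-onto j)))

  strongBridge⇒bridge : StrongBridge G S f → Bridge S f
  strongBridge⇒bridge {S = S} {f = f} (_ , _ , _ , count , count′ , more) with bridge? S f
  ... | yes bridge = bridge
  ... | no ¬bridge =
    contradiction (sccCount-anti count count′ (sameSCC-delete-nonBridge ¬bridge)) (<⇒≱ more)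

  rep : Subset (m G) → Fin n → Fin n
  rep S v = firstRelated (sameSCC? S) v (allFin n)

  rep-sameSCC : SameSCC G S (rep S v) v
  rep-sameSCC {S = S} = firstRelated-related (sameSCC? S) sameSCC-refl (allFin n)

  rep-cong : SameSCC G S u v → rep S u ≡ rep S v
  rep-cong {S = S} u~v = firstRelated-cong (sameSCC? S) sameSCC-isEquivalence u~v (∈-allFin _)

  rep≡⇒sameSCC : rep S u ≡ rep S v → SameSCC G S u v
  rep≡⇒sameSCC {S = S} {u} {v} eq =
    sameSCC-trans (sameSCC-sym rep-sameSCC) (subst (λ r → SameSCC G S r v) (sym eq) rep-sameSCC)

  rep-idem : rep S (rep S v) ≡ rep S v
  rep-idem = rep-cong rep-sameSCC

  rep-rep-⊆ : T ⊆ S → rep S (rep T v) ≡ rep S v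
  rep-rep-⊆ T⊆S = rep-cong (sameSCC-mono T⊆S rep-sameSCC)

  rep-fixed-⊆ : T ⊆ S → rep S v ≡ v → rep T v ≡ v
  rep-fixed-⊆ {T} {S} T⊆S =
    firstRelated-fixed-⇒ (sameSCC? S) (sameSCC? T) (sameSCC-mono T⊆S) sameSCC-refl (allFin n)

  nonRep? : ∀ S v → Dec (rep S v ≢ v)
  nonRep? S v = ¬? (rep S v ≟ v)

  -- There are n ∸ length (nonReps S) SCCs.
  nonReps : Subset (m G) → List (Fin n)
  nonReps S = filter (nonRep? S) (allFin n)

  length-nonReps : length (nonReps S) ≤ n ∸ 1
  length-nonReps {S = S} = subst (λ l → length (nonReps S) ≤ l ∸ 1) (length-tabulate {n = n} id)
    (length-nonFirst (sameSCC? S) _≟_ sameSCC-refl (allFin n))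

  NewRep : Subset (m G) → Subset (m G) → Fin n → Set
  NewRep S T v = rep S v ≢ v × rep T v ≡ v

  newRep? : ∀ S T v → Dec (NewRep S T v)
  newRep? S T v = nonRep? S v ×-dec (rep T v ≟ v)

  newReps : Subset (m G) → Subset (m G) → List (Fin n)
  newReps S T = filter (newRep? S T) (allFin n)

  newReps+nonReps : T ⊆ S → length (newReps S T) + length (nonReps T) ≤ length (nonReps S)
  newReps+nonReps {T} {S} T⊆S = subst (_≤ length (nonReps S)) (length-++ (newReps S T))
    (unique-⊆⇒length≤ _≟_
      (++⁺ (filter⁺ (newRep? S T) (allFin⁺ n)) (filter⁺ (nonRep? T) (allFin⁺ n)) disjoint) ⊆nonReps)
    where
    new⁻ : v ∈ newReps S T → NewRep S T v
    new⁻ new = proj₂ (∈-filter⁻ (newRep? S T) {xs = allFin n} new)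
    non⁻ : v ∈ nonReps T → rep T v ≢ v
    non⁻ non = proj₂ (∈-filter⁻ (nonRep? T) {xs = allFin n} non)
    disjoint : Disjoint (newReps S T) (nonReps T)
    disjoint (new , non) = non⁻ non (proj₂ (new⁻ new))
    ⊆nonReps : v ∈ newReps S T ++ nonReps T → v ∈ nonReps S
    ⊆nonReps {v} v∈ with ∈-++⁻ (newReps S T) v∈
    ... | inj₁ new = ∈-filter⁺ (nonRep? S) (∈-allFin v) (proj₁ (new⁻ new))
    ... | inj₂ non = ∈-filter⁺ (nonRep? S) (∈-allFin v) λ fixed → non⁻ non (rep-fixed-⊆ T⊆S fixed)

  module LostBridges (S : Subset (m G)) (d : Fin (m G)) where

    S′ : Subset (m G)
    S′ = delete S d

    a b : Fin n
    a = tail G d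
    b = head G d

    Lost : Fin (m G) → Set
    Lost f = Bridge S f × ¬ Bridge S′ f

    lost? : ∀ f → Dec (Lost f)
    lost? f = bridge? S f ×-dec ¬? (bridge? S′ f)

    lostBridges : List (Fin (m G))
    lostBridges = filter lost? (allFin (m G))

    nonBridge-loses-nothing : ¬ Bridge S d → ¬ Lost f
    nonBridge-loses-nothing ¬d-bridge (f-bridge@(f∈ , t~h , _) , ¬f-bridge′) =
      ¬f-bridge′ (bridge-⊆ f-bridge delete-⊆ (∈-delete⁺ f∈ λ { refl → ¬d-bridge f-bridge })
                            (sameSCC-delete-nonBridge ¬d-bridge t~h))

    Exits : Fin (m G) → Set
    Exits f = ¬ Reach G (delete S′ f) (tail G f) a

    Enters : Fin (m G) → Set
    Enters f = ¬ Reach G (delete S′ f) b (head G f) × ¬ SameSCC G S′ (head G f) a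

    module _ (d-bridge : Bridge S d) where

      private
        a~b : SameSCC G S a b
        a~b = proj₁ (proj₂ d-bridge)

      module _ {f} (f-lost : Lost f) (f≢d : f ≢ d) where

        private
          f∈S : f ∈ₛ S
          f∈S = proj₁ (proj₁ f-lost)
          t~h : SameSCC G S (tail G f) (head G f)
          t~h = proj₁ (proj₂ (proj₁ f-lost))

        lost-∈ : f ∈ₛ S′
        lost-∈ = ∈-delete⁺ f∈S f≢d

        lost-split : ¬ SameSCC G S′ (tail G f) (head G f)
        lost-split t~h′ = proj₂ f-lost (bridge-⊆ (proj₁ f-lost) delete-⊆ lost-∈ t~h′)

        lost-tail~a : SameSCC G S (tail G f) a
        lost-tail~a with sameSCC-delete (proj₁ d-bridge) t~h
        ... | inj₁ t~h′ = contradiction t~h′ lost-split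
        ... | inj₂ (t~a , _) = t~a

        lost-head~a : SameSCC G S (head G f) a
        lost-head~a = sameSCC-trans (sameSCC-sym t~h) lost-tail~a

        reach-avoiding : SameSCC G S′ x y → Reach G (delete S′ f) x y
        reach-avoiding = sameSCC⇒reach-delete lost-∈ lost-split

        b⇝tail : Reach G (delete S′ f) b (tail G f)
        b⇝tail = reach-to-tail (reach-from-head (reach-trans (proj₂ a~b) (proj₂ lost-tail~a)))

        b⇝head : Reach G S′ b (head G f)
        b⇝head = reach-from-head (reach-trans (proj₂ a~b) (proj₂ lost-head~a))

        head⇝a : Exits f → Reach G S′ (head G f) a
        head⇝a ¬t⇝a with reach-first-use {f = f} (reach-to-tail (proj₁ lost-tail~a))
        ... | inj₁ t⇝a = contradiction t⇝a ¬t⇝a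
        ... | inj₂ (_ , h⇝a) = h⇝a

        -- Otherwise tail f ⇝ a, d, b ⇝ head f would close a cycle through f avoiding f in S.
        exits-if-b⇝head : Reach G (delete S′ f) b (head G f) → Exits f
        exits-if-b⇝head b⇝h t⇝a = proj₂ (proj₂ (proj₁ f-lost))
          ( reach-trans (reach-mono (delete-mono delete-⊆) t⇝a)
              (reach-trans (edge-reach (∈-delete⁺ (proj₁ d-bridge) λ d≡f → f≢d (sym d≡f)))
                           (reach-mono (delete-mono delete-⊆) b⇝h))
          , reach-to-tail (proj₂ t~h))

        exits-if-head~a : SameSCC G S′ (head G f) a → Exits f
        exits-if-head~a h~a t⇝a =
          exits-if-b⇝head (reach-trans b⇝tail (reach-trans t⇝a (reach-avoiding (sameSCC-sym h~a)))) t⇝a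

      enters-not-with-b : Lost f → f ≢ d → Enters f → ¬ SameSCC G S′ (head G f) b
      enters-not-with-b f-lost f≢d (¬b⇝h , _) h~b = ¬b⇝h (reach-avoiding f-lost f≢d (sameSCC-sym h~b))

      -- A path in S′ from b to head g must use f, and before f it must use g; that closes a cycle
      -- through f in S′.
      enters-injective : Lost f → f ≢ d → Enters f → Lost g → g ≢ d → Enters g →
                         SameSCC G S′ (head G f) (head G g) → f ≡ g
      enters-injective {f} {g} f-lost f≢d (¬b⇝hf , _) g-lost g≢d (¬b⇝hg , _) hf~hg with f ≟ g
      ... | yes f≡g = f≡g
      ... | no f≢g with reach-first-use {f = f} (b⇝head g-lost g≢d)
      ...   | inj₁ b⇝hg =
                contradiction (reach-trans b⇝hg (reach-avoiding f-lost f≢d (sameSCC-sym hf~hg))) ¬b⇝hf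
      ...   | inj₂ (b⇝tf , _) with reach-first-use {f = g} b⇝tf
      ...     | inj₁ b⇝tf′ = contradiction
                  (reach-trans (reach-mono (delete-mono delete-⊆) b⇝tf′)
                               (step f (∈-delete⁺ (lost-∈ f-lost f≢d) f≢g) refl
                                       (reach-avoiding g-lost g≢d hf~hg)))
                  ¬b⇝hg
      ...     | inj₂ (_ , hg⇝tf) = contradiction
                  (edge-reach (lost-∈ f-lost f≢d) , reach-trans (proj₁ hf~hg) (reach-mono delete-⊆ hg⇝tf))
                  (lost-split f-lost f≢d)

      -- Dually: a path in S′ from head f to a must use g, closing a cycle through f in S′.
      exits-injective : Lost f → f ≢ d → Exits f → Lost g → g ≢ d → Exits g →
                        SameSCC G S′ (tail G f) (tail G g) → f ≡ g
      exits-injective {f} {g} f-lost f≢d ¬tf⇝a g-lost g≢d ¬tg⇝a tf~tg with f ≟ g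
      ... | yes f≡g = f≡g
      ... | no f≢g with reach-first-use {f = g} (head⇝a f-lost f≢d ¬tf⇝a)
      ...   | inj₁ hf⇝a = contradiction
                (reach-trans (reach-avoiding g-lost g≢d (sameSCC-sym tf~tg))
                             (step f (∈-delete⁺ (lost-∈ f-lost f≢d) f≢g) refl hf⇝a))
                ¬tg⇝a
      ...   | inj₂ (hf⇝tg , _) = contradiction
                (edge-reach (lost-∈ f-lost f≢d) , reach-trans (reach-mono delete-⊆ hf⇝tg) (proj₂ tf~tg))
                (lost-split f-lost f≢d)

      -- inj₁ x charges the SCC of x in S′ for an entering edge, inj₂ x for an exiting one.
      chargePoint : Fin (m G) → Fin n ⊎ Fin n
      chargePoint f with f ≟ d | reach? (delete S′ f) b (head G f) | sameSCC? S′ (head G f) a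
      ... | yes _ | _ | _ = inj₁ b
      ... | no _ | no _ | no _ = inj₁ (head G f)
      ... | no _ | _ | _ = inj₂ (tail G f)

      data Charged (f : Fin (m G)) : Fin n ⊎ Fin n → Set where
        deleted : f ≡ d → Charged f (inj₁ b)
        enters : f ≢ d → Enters f → Charged f (inj₁ (head G f))
        exits : f ≢ d → Exits f → Charged f (inj₂ (tail G f))

      charged : Lost f → Charged f (chargePoint f)
      charged {f} f-lost with f ≟ d | reach? (delete S′ f) b (head G f) | sameSCC? S′ (head G f) a
      ... | yes f≡d | _ | _ = deleted f≡d
      ... | no f≢d | no ¬b⇝h | no h≁a = enters f≢d (¬b⇝h , h≁a)
      ... | no f≢d | yes b⇝h | _ = exits f≢d (exits-if-b⇝head f-lost f≢d b⇝h)
      ... | no f≢d | no _ | yes h~a = exits f≢d (exits-if-head~a f-lost f≢d h~a)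

      charged-injective : ∀ {c c′} → Lost f → Charged f c → Lost g → Charged g c′ →
                          Pointwise (SameSCC G S′) (SameSCC G S′) c c′ → f ≡ g
      charged-injective _ (deleted f≡d) _ (deleted g≡d) _ = trans f≡d (sym g≡d)
      charged-injective _ (deleted _) g-lost (enters g≢d g-enters) (inj₁ b~hg) =
        contradiction (sameSCC-sym b~hg) (enters-not-with-b g-lost g≢d g-enters)
      charged-injective f-lost (enters f≢d f-enters) _ (deleted _) (inj₁ hf~b) =
        contradiction hf~b (enters-not-with-b f-lost f≢d f-enters)
      charged-injective f-lost (enters f≢d f-enters) g-lost (enters g≢d g-enters) (inj₁ hf~hg) =
        enters-injective f-lost f≢d f-enters g-lost g≢d g-enters hf~hg
      charged-injective f-lost (exits f≢d f-exits) g-lost (exits g≢d g-exits) (inj₂ tf~tg) =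
        exits-injective f-lost f≢d f-exits g-lost g≢d g-exits tf~tg

      Detached : Fin n → Set
      Detached x = SameSCC G S x a × ¬ SameSCC G S′ x a

      charged-detached : ∀ {c} → Lost f → Charged f c → Detached (reduce c)
      charged-detached _ (deleted _) = sameSCC-sym a~b , λ b~a′ → proj₂ (proj₂ d-bridge) (sameSCC-sym b~a′)
      charged-detached f-lost (enters f≢d (_ , h≁a)) = lost-head~a f-lost f≢d , h≁a
      charged-detached f-lost (exits f≢d ¬t⇝a) =
        lost-tail~a f-lost f≢d , λ t~a → ¬t⇝a (reach-avoiding f-lost f≢d t~a)

      -- rep S a stays a representative in S′, possibly of a detached piece; there it is traded for
      -- rep S′ a, which is then new.
      swapOldRep : Fin n → Fin n
      swapOldRep v with v ≟ rep S a
      ... | yes _ = rep S′ a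
      ... | no _ = v

      newRepOf : Fin n → Fin n
      newRepOf x = swapOldRep (rep S′ x)

      newRepOf-newRep : Detached x → NewRep S S′ (newRepOf x)
      newRepOf-newRep {x} (x~a , x≁a′) with rep S′ x ≟ rep S a
      ... | yes x′≡a =
        (λ a′-fixed → x≁a′ (rep≡⇒sameSCC (trans x′≡a (trans (sym (rep-rep-⊆ delete-⊆)) a′-fixed))))
        , rep-idem
      ... | no x′≢a =
        (λ x′-fixed → x′≢a (trans (sym x′-fixed) (trans (rep-rep-⊆ delete-⊆) (rep-cong x~a))))
        , rep-idem

      newRepOf-injective : Detached x → Detached y → newRepOf x ≡ newRepOf y → SameSCC G S′ x y
      newRepOf-injective {x} {y} (_ , x≁a′) (_ , y≁a′) eq with rep S′ x ≟ rep S a | rep S′ y ≟ rep S a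
      ... | yes x′≡a | yes y′≡a = rep≡⇒sameSCC (trans x′≡a (sym y′≡a))
      ... | yes _ | no _ = contradiction (sameSCC-sym (rep≡⇒sameSCC eq)) y≁a′
      ... | no _ | yes _ = contradiction (rep≡⇒sameSCC eq) x≁a′
      ... | no _ | no _ = rep≡⇒sameSCC eq

      charge : Fin (m G) → Fin n ⊎ Fin n
      charge f = Sum.map newRepOf newRepOf (chargePoint f)

      chargeSlots : List (Fin n ⊎ Fin n)
      chargeSlots = map inj₁ (newReps S S′) ++ map inj₂ (newReps S S′)

      length-chargeSlots : length chargeSlots ≡ 2 * length (newReps S S′)
      length-chargeSlots = trans (length-++ (map inj₁ (newReps S S′)))
        (cong₂ _+_ (length-map inj₁ (newReps S S′))
                   (trans (length-map inj₂ (newReps S S′)) (sym (+-identityʳ _))))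

      charge-injective : Lost f → Lost g → charge f ≡ charge g → f ≡ g
      charge-injective {f} {g} f-lost g-lost eq =
        charged-injective f-lost (charged f-lost) g-lost (charged g-lost)
          (related (charged-detached f-lost (charged f-lost)) (charged-detached g-lost (charged g-lost)) eq)
        where
        related : ∀ {c c′} → Detached (reduce c) → Detached (reduce c′) →
                  Sum.map newRepOf newRepOf c ≡ Sum.map newRepOf newRepOf c′ →
                  Pointwise (SameSCC G S′) (SameSCC G S′) c c′
        related {inj₁ _} {inj₁ _} dx dy eq = inj₁ (newRepOf-injective dx dy (inj₁-injective eq))
        related {inj₂ _} {inj₂ _} dx dy eq = inj₂ (newRepOf-injective dx dy (inj₂-injective eq))

      charge-∈ : Lost f → charge f ∈ chargeSlots
      charge-∈ {f} f-lost = slot {chargePoint f} (charged-detached f-lost (charged f-lost))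
        where
        new : Detached x → newRepOf x ∈ newReps S S′
        new dx = ∈-filter⁺ (newRep? S S′) (∈-allFin _) (newRepOf-newRep dx)
        slot : ∀ {c} → Detached (reduce c) → Sum.map newRepOf newRepOf c ∈ chargeSlots
        slot {inj₁ _} dx = ∈-++⁺ˡ (∈-map⁺ inj₁ (new dx))
        slot {inj₂ _} dx = ∈-++⁺ʳ (map inj₁ (newReps S S′)) (∈-map⁺ inj₂ (new dx))

      length-lostBridges-of-bridge : length lostBridges ≤ 2 * length (newReps S S′)
      length-lostBridges-of-bridge = begin
        length lostBridges               ≡⟨ length-map charge lostBridges ⟨
        length (map charge lostBridges)  ≤⟨ unique-⊆⇒length≤ (Sum.≡-dec _≟_ _≟_) charges-unique
                                                                charges-⊆ ⟩
        length chargeSlots               ≡⟨ length-chargeSlots ⟩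
        2 * length (newReps S S′)        ∎
        where
        open ≤-Reasoning
        lost : f ∈ lostBridges → Lost f
        lost f∈ = proj₂ (∈-filter⁻ lost? {xs = allFin (m G)} f∈)
        charges-unique : Unique (map charge lostBridges)
        charges-unique =
          map-unique (filter⁺ lost? (allFin⁺ (m G))) λ f∈ g∈ → charge-injective (lost f∈) (lost g∈)
        charges-⊆ : ∀ {c} → c ∈ map charge lostBridges → c ∈ chargeSlots
        charges-⊆ c∈ with ∈-map⁻ charge c∈
        ... | _ , f∈ , refl = charge-∈ (lost f∈)

    length-lostBridges : length lostBridges ≤ 2 * length (newReps S S′)
    length-lostBridges with bridge? S d
    ... | yes d-bridge = length-lostBridges-of-bridge d-bridge
    ... | no ¬d-bridge = subst (λ l → length l ≤ 2 * length (newReps S S′))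
      (sym (filter-none lost? {xs = allFin (m G)} (All.tabulate λ _ → nonBridge-loses-nothing ¬d-bridge)))
      z≤n

  open LostBridges using (lostBridges; lost?; length-lostBridges)

  length-lostBridges+nonReps : ∀ S d →
    length (lostBridges S d) + 2 * length (nonReps (delete S d)) ≤ 2 * length (nonReps S)
  length-lostBridges+nonReps S d = begin
    length (lostBridges S d) + 2 * length (nonReps S′)      ≤⟨ +-monoˡ-≤ _ (length-lostBridges S d) ⟩
    2 * length (newReps S S′) + 2 * length (nonReps S′)    ≡⟨ *-distribˡ-+ 2 (length (newReps S S′)) _ ⟨
    2 * (length (newReps S S′) + length (nonReps S′))      ≤⟨ *-monoʳ-≤ 2 (newReps+nonReps delete-⊆) ⟩
    2 * length (nonReps S)                                 ∎
    where
    open ≤-Reasoning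
    S′ = delete S d

  everBridge? : ∀ S ds e → Dec (Any (λ T → Bridge T e) (graphsFrom S ds))
  everBridge? S ds e = any? (λ T → bridge? T e) (graphsFrom S ds)

  everBridges : Subset (m G) → List (Fin (m G)) → List (Fin (m G))
  everBridges S ds = filter (everBridge? S ds) (allFin (m G))

  length-everBridges : ∀ S ds → (∀ {e} → e ∈ₛ S → e ∈ ds) →
                       length (everBridges S ds) ≤ 2 * length (nonReps S)
  length-everBridges S [] covered = subst (λ l → length l ≤ 2 * length (nonReps S))
    (sym (filter-none (everBridge? S []) {xs = allFin (m G)} (All.tabulate λ _ → never))) z≤n
    where
    never : ¬ Any (λ T → Bridge T e) (S ∷ [])
    never (here (e∈ , _)) with () ← covered e∈
  length-everBridges S (d ∷ ds) covered = begin
    length (everBridges S (d ∷ ds))                        ≤⟨ unique-⊆⇒length≤ _≟_ unique ⊆step ⟩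
    length (lostBridges S d ++ everBridges S′ ds)          ≡⟨ length-++ (lostBridges S d) ⟩
    length (lostBridges S d) + length (everBridges S′ ds)
      ≤⟨ +-monoʳ-≤ _ (length-everBridges S′ ds covered′) ⟩
    length (lostBridges S d) + 2 * length (nonReps S′)     ≤⟨ length-lostBridges+nonReps S d ⟩
    2 * length (nonReps S)                                 ∎
    where
    open ≤-Reasoning
    S′ = delete S d
    unique : Unique (everBridges S (d ∷ ds))
    unique = filter⁺ (everBridge? S (d ∷ ds)) (allFin⁺ (m G))
    covered′ : ∀ {e} → e ∈ₛ S′ → e ∈ ds
    covered′ e∈ with covered (delete-⊆ e∈)
    ... | here refl = contradiction e∈ ∉-delete
    ... | there e∈ds = e∈ds
    ⊆step : e ∈ everBridges S (d ∷ ds) → e ∈ lostBridges S d ++ everBridges S′ ds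
    ⊆step {e} e∈
      with proj₂ (∈-filter⁻ (everBridge? S (d ∷ ds)) {xs = allFin (m G)} e∈) | everBridge? S′ ds e
    ... | _ | yes later = ∈-++⁺ʳ (lostBridges S d) (∈-filter⁺ (everBridge? S′ ds) (∈-allFin e) later)
    ... | there later | no ¬later = contradiction later ¬later
    ... | here e-bridge | no ¬later = ∈-++⁺ˡ (∈-filter⁺ (lost? S d) (∈-allFin e)
                                          (e-bridge , λ e-bridge′ → ¬later (graphsFrom-head ds e-bridge′)))

lemma16 : ∀ {n} (G : Digraph n) (ds : List (Fin (m G))) (B : List (Fin (m G))) →
          Unique B →
          All (λ e → ∃ λ (S : Subset (m G)) → S ∈ graphsDuring G ds × StrongBridge G S e) B →
          length B ≤ 2 * (n ∸ 1)
lemma16 {n} G ds B B-unique B-bridges = begin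
  length B                      ≤⟨ unique-⊆⇒length≤ _≟_ B-unique B⊆ ⟩
  length (everBridges G ⊤ ds′)  ≤⟨ length-everBridges G ⊤ ds′ (λ {e} _ → ∈-++⁺ʳ ds (∈-allFin e)) ⟩
  2 * length (nonReps G ⊤)      ≤⟨ *-monoʳ-≤ 2 (length-nonReps G) ⟩
  2 * (n ∸ 1)                   ∎
  where
  open ≤-Reasoning
  ds′ = ds ++ allFin (m G)
  B⊆ : ∀ {e} → e ∈ B → e ∈ everBridges G ⊤ ds′
  B⊆ {e} e∈B with All.lookup B-bridges e∈B
  ... | S , S∈ , strong = ∈-filter⁺ (everBridge? G ⊤ ds′) (∈-allFin e)
                            (graphsFrom-++ ds (allFin (m G)) (lose S∈ (strongBridge⇒bridge G strong)))
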